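{- Let $F_1\subset F_2\subset\cdots\subset F_d$ be faces of $\partial\sigma^{d+1}$ with $\dim F_i=i$ for all $i$. Then $\mathrm{sd}_{F_1}\circ\mathrm{sd}_{F_2}\circ\cdots\circ\mathrm{sd}_{F_d}(\partial\sigma^{d+1})\cong\mathcal{C}_d$, i.e., stellarly subdividing successively at $F_d$, then $F_{d-1}$, ..., then $F_1$ yields a complex isomorphic to the boundary of the $(d+1)$-dimensional cross-polytope.
   Context: $\partial\sigma^{d+1}$ denotes the boundary complex of a $(d+1)$-simplex. The stellar subdivision at a face $F$ is $\mathrm{sd}_F(\Delta)=(\Delta\setminus F)\cup(\overline{a}*\partial\overline{F}*\mathrm{lk}_\Delta(F))$, with $a$ a new vertex, $\Delta\setminus F$ the faces not containing $F$, $\mathrm{lk}_\Delta(F)=\{G\in\Delta:G\cap F=\emptyset, G\cup F\in\Delta\}$, $*$ the join. $\mathcal{C}_d$ is the complex on $\{x_0,\dots,x_d,y_0,\dots,y_d\}$ whose faces are the sets $F$ with $|F\cap\{x_i,y_i\}|\le1$ for all $i$. -}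

module Defs where

open import Data.Nat using (ℕ; zero; suc; _+_)
open import Data.Bool using (Bool; true; false)
open import Data.Fin using (Fin; zero; suc; _↑ˡ_; _↑ʳ_)
open import Data.Fin.Subset using (Subset; _⊆_; _⊂_; _∩_; _∪_; ⊥; ⊤; _∈_)
open import Data.Vec using (Vec; _∷_; replicate; _++_; lookup; tabulate)
open import Data.Product using (Σ; _×_; ∃)
open import Data.Sum using (_⊎_)
open import Relation.Nullary using (¬_)
open import Relation.Binary.PropositionalEquality using (_≡_)
open import Function.Bundles using (_↔_; _⇔_; Inverse)

Complex : ℕ → Set₁
Complex n = Subset n → Set

BdSimplex : (d : ℕ) → Complex (suc (suc d))
BdSimplex d S = ¬ (S ≡ ⊤)

Link : {n : ℕ} → Complex n → Subset n → Complex n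
Link K F G = K G × (G ∩ F ≡ ⊥) × K (G ∪ F)

-- faces of the join ∂F̄ * lk_K(F) (without the apex):
-- sets G ∪ H with G a proper subset of F and H ∈ lk_K(F)
BdJoinLink : {n : ℕ} → Complex n → Subset n → Complex n
BdJoinLink K F S =
  Σ (Subset _) λ G → Σ (Subset _) λ H →
    (G ⊂ F) × Link K F H × (S ≡ G ∪ H)

-- Stellar subdivision sd_F(K) = (K ∖ F) ∪ (ā * ∂F̄ * lk_K(F)).
-- The new vertex a is vertex `zero` of Fin (suc n); the old vertex v
-- becomes `suc v`.  A subset of Fin (suc n) is  b ∷ S  with b telling
-- whether a belongs to it.
sd : {n : ℕ} → Subset n → Complex n → Complex (suc n)
sd F K (false ∷ S) = (K S × ¬ (F ⊆ S)) ⊎ BdJoinLink K F S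
sd F K (true  ∷ S) = BdJoinLink K F S

liftSub : {n : ℕ} (k : ℕ) → Subset n → Subset (k + n)
liftSub k S = replicate k false ++ S

-- sdChain k Fs K = sd_{Fs 0} ∘ sd_{Fs 1} ∘ ⋯ ∘ sd_{Fs (k-1)} (K),
-- i.e. one subdivides first at Fs (k-1), ..., last at Fs 0
-- (each Fs i a set of original vertices of K).
sdChain : {n : ℕ} (k : ℕ) → (Fin k → Subset n) → Complex n → Complex (k + n)
sdChain zero    Fs K = K
sdChain (suc k) Fs K = sd (liftSub k (Fs zero)) (sdChain k (λ i → Fs (suc i)) K)

-- Boundary of the (d+1)-dimensional cross-polytope 𝒞_d on vertices
-- Fin (suc d + suc d), with x_i = i ↑ˡ suc d and y_i = suc d ↑ʳ i:
-- faces are sets containing at most one of x_i, y_i for each i.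
Cross : (d : ℕ) → Complex (suc d + suc d)
Cross d S = (i : Fin (suc d)) → ¬ (((i ↑ˡ suc d) ∈ S) × ((suc d ↑ʳ i) ∈ S))

_≅_ : {n m : ℕ} → Complex n → Complex m → Set
_≅_ {n} {m} K L =
  Σ (Fin n ↔ Fin m) λ σ →
    (S : Subset n) → K S ⇔ L (tabulate (λ j → lookup S (Inverse.from σ j)))

-- Subdividing at F_d, …, F_1 adds one apex a_i per face, and the faces of
-- the result are exactly the vertex sets S that do not contain all of F_1
-- and never contain a_i together with the vertex w_i of F_{i+1} ∖ F_i
-- (with F_{d+1} the whole vertex set).  Writing F_1 = {u, u'}, the pairs
-- {u, u'} and {a_i, w_i} partition the vertex set into d + 1 pairs, and the
-- faces are precisely the sets containing no pair: the cross-polytope.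
-- The description is proved by induction along the flag; one stellar
-- subdivision at F_1 turns the description for F_2 ⊂ ⋯ into the one for F_1 ⊂ ⋯
-- by splitting a face S ∋ a_1 as (S ∩ F_1) ∪ (S ∖ F_1).

module Submission where

open import Defs
open import Data.Nat using (ℕ; zero; suc; _+_; z≤n; s≤s) renaming (_≤_ to _≤ℕ_)
open import Data.Nat.Properties using (+-suc; <⇒≱; 1+n≰n)
open import Data.Fin using (Fin; zero; suc; toℕ; _≤_; _↑ˡ_; _↑ʳ_; splitAt)
open import Data.Fin.Properties
  using (+↔⊎; ↑ˡ-injective; ↑ʳ-injective; splitAt-↑ˡ; splitAt-↑ʳ; splitAt⁻¹-↑ˡ; splitAt⁻¹-↑ʳ)
  renaming (suc-injective to fsuc-injective)
open import Data.Fin.Subset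
  using (Subset; _⊆_; _⊂_; _∈_; _∉_; _∪_; _∩_; ∁; ⁅_⁆; ⊤; ⊥; ∣_∣; Nonempty)
open import Data.Fin.Subset.Properties
open import Data.Vec using (_∷_; drop; lookup; tabulate; _[_]=_)
open import Data.Vec.Properties using ([]=⇒lookup; lookup⇒[]=; lookup∘tabulate)
open import Data.Bool using (true; false)
open import Data.Product using (∃; _×_; _,_; proj₁; proj₂)
open import Data.Sum using (_⊎_; inj₁; inj₂)
open import Data.Empty using (⊥-elim)
open import Function using (_∘_)
open import Function.Bundles using (_↔_; _⇔_; Inverse; Equivalence; mk⇔; mk⤖)
open import Function.Consequences.Propositional using (strictlySurjective⇒surjective)
open import Function.Properties.Bijection using (⤖⇒↔)
open import Function.Properties.Inverse using (↔-sym; ↔-trans)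
import Function.Properties.Equivalence as ⇔
open import Relation.Nullary using (¬_; yes; no; contradiction)
open import Relation.Binary.PropositionalEquality
  using (_≡_; _≢_; refl; sym; trans; cong; subst; module ≡-Reasoning)

open _[_]=_
open Equivalence

private variable
  k m n : ℕ

⊈⇒∃∉ : {p q : Subset n} → ¬ (p ⊆ q) → ∃ λ x → x ∈ p × x ∉ q
⊈⇒∃∉ {p = p} {q} p⊈q with nonempty? (p ∩ ∁ q)
... | yes (x , x∈p∖q) = let x∈p , x∈∁q = x∈p∩q⁻ p (∁ q) x∈p∖q in x , x∈p , x∈∁p⇒x∉p x∈∁q
... | no empty = ⊥-elim (p⊈q λ x∈p → x∉∁p⇒x∈p λ x∈∁q → empty (_ , x∈p∩q⁺ (x∈p , x∈∁q)))

⁅⁆⊆ : {p : Subset n} {x : Fin n} → x ∈ p → ⁅ x ⁆ ⊆ p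
⁅⁆⊆ {x = x} x∈p y∈⁅x⁆ = subst (_∈ _) (sym (x∈⁅y⁆⇒x≡y x y∈⁅x⁆)) x∈p

∪⁅⁆⊆ : {p r : Subset n} {x : Fin n} → p ⊆ r → x ∈ r → p ∪ ⁅ x ⁆ ⊆ r
∪⁅⁆⊆ {p = p} {x = x} p⊆r x∈r y∈ with x∈p∪q⁻ p ⁅ x ⁆ y∈
... | inj₁ y∈p = p⊆r y∈p
... | inj₂ y∈⁅x⁆ = ⁅⁆⊆ x∈r y∈⁅x⁆

⊆∧∣⊇∣⇒≡ : {p q : Subset n} → p ⊆ q → ∣ q ∣ ≤ℕ ∣ p ∣ → p ≡ q
⊆∧∣⊇∣⇒≡ {p = p} {q} p⊆q ∣q∣≤∣p∣ with q ⊆? p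
... | yes q⊆p = ⊆-antisym p⊆q q⊆p
... | no q⊈p =
  let x , x∈q , x∉p = ⊈⇒∃∉ q⊈p
  in contradiction ∣q∣≤∣p∣ (<⇒≱ (p⊂q⇒∣p∣<∣q∣ (p⊆q , x , x∈q , x∉p)))

nonempty-∣∣ : {p : Subset n} → ∣ p ∣ ≡ suc m → Nonempty p
nonempty-∣∣ {n} {p = p} ∣p∣≡ with nonempty? p
... | yes ne = ne
... | no empty with trans (sym ∣p∣≡) (trans (cong ∣_∣ (Empty-unique empty)) (∣⊥∣≡0 n))
...   | ()

⊆∧∣∣≡suc⇒∪⁅⁆ : {p q : Subset n} → p ⊆ q → ∣ q ∣ ≡ suc ∣ p ∣ →
  ∃ λ v → v ∉ p × q ≡ p ∪ ⁅ v ⁆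
⊆∧∣∣≡suc⇒∪⁅⁆ {p = p} {q} p⊆q ∣q∣≡ =
  let v , v∈q , v∉p = ⊈⇒∃∉ q⊈p
      p⊂p∪v : p ⊂ p ∪ ⁅ v ⁆
      p⊂p∪v = p⊆p∪q ⁅ v ⁆ , v , x∈p∪q⁺ (inj₂ (x∈⁅x⁆ v)) , v∉p
  in v , v∉p , sym (⊆∧∣⊇∣⇒≡ (∪⁅⁆⊆ p⊆q v∈q) (subst (_≤ℕ ∣ p ∪ ⁅ v ⁆ ∣) (sym ∣q∣≡) (p⊂q⇒∣p∣<∣q∣ p⊂p∪v)))
  where
  q⊈p : ¬ (q ⊆ p)
  q⊈p q⊆p = 1+n≰n (subst (_≤ℕ ∣ p ∣) ∣q∣≡ (p⊆q⇒∣p∣≤∣q∣ q⊆p))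

∈-drop⁺ : {S : Subset (k + n)} {x : Fin n} → k ↑ʳ x ∈ S → x ∈ drop k S
∈-drop⁺ {zero} x∈S = x∈S
∈-drop⁺ {suc k} {S = _ ∷ S} (there x∈S) = ∈-drop⁺ {k} x∈S

∈-drop⁻ : {S : Subset (k + n)} {x : Fin n} → x ∈ drop k S → k ↑ʳ x ∈ S
∈-drop⁻ {zero} x∈S = x∈S
∈-drop⁻ {suc k} {S = _ ∷ S} x∈S = there (∈-drop⁻ {k} x∈S)

drop-mono : {S T : Subset (k + n)} → S ⊆ T → drop k S ⊆ drop k T
drop-mono {k} S⊆T = ∈-drop⁺ {k} ∘ S⊆T ∘ ∈-drop⁻ {k}

↑ʳ∈liftSub⁺ : {X : Subset n} {x : Fin n} → x ∈ X → k ↑ʳ x ∈ liftSub k X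
↑ʳ∈liftSub⁺ {k = zero} x∈X = x∈X
↑ʳ∈liftSub⁺ {k = suc k} x∈X = there (↑ʳ∈liftSub⁺ {k = k} x∈X)

↑ʳ∈liftSub⁻ : {X : Subset n} {x : Fin n} → k ↑ʳ x ∈ liftSub k X → x ∈ X
↑ʳ∈liftSub⁻ {k = zero} x∈X = x∈X
↑ʳ∈liftSub⁻ {k = suc k} (there x∈X) = ↑ʳ∈liftSub⁻ {k = k} x∈X

↑ˡ∉liftSub : {X : Subset n} (i : Fin k) → i ↑ˡ n ∉ liftSub k X
↑ˡ∉liftSub (suc i) (there i∈X) = ↑ˡ∉liftSub i i∈X

liftSub-⊆ : {X : Subset n} {S : Subset (k + n)} → X ⊆ drop k S → liftSub k X ⊆ S
liftSub-⊆ {k = zero} X⊆S = X⊆S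
liftSub-⊆ {k = suc k} {S = _ ∷ S} X⊆S (there y∈X) = there (liftSub-⊆ {k = k} X⊆S y∈X)

liftSub-⊆⁻ : {X : Subset n} {S : Subset (k + n)} → liftSub k X ⊆ S → X ⊆ drop k S
liftSub-⊆⁻ {k = k} X⊆S = ∈-drop⁺ {k} ∘ X⊆S ∘ ↑ʳ∈liftSub⁺ {k = k}

-- Complete flags

withTop : (Fin k → Subset n) → Fin (suc k) → Subset n
withTop {k = zero}  Fs _       = ⊤
withTop {k = suc k} Fs zero    = Fs zero
withTop {k = suc k} Fs (suc i) = withTop (λ j → Fs (suc j)) i

record Flag (k n : ℕ) : Set where
  field
    face       : Fin k → Subset n
    newVertex  : Fin k → Fin n
    newVertex∉ : ∀ i → newVertex i ∉ face i
    extends    : ∀ i → withTop face (suc i) ≡ face i ∪ ⁅ newVertex i ⁆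
    nonempty   : ∀ i → Nonempty (face i)

  bottom : Subset n
  bottom = withTop face zero

open Flag

tail : Flag (suc k) n → Flag k n
tail φ = record
  { face       = λ i → face φ (suc i)
  ; newVertex  = λ i → newVertex φ (suc i)
  ; newVertex∉ = λ i → newVertex∉ φ (suc i)
  ; extends    = λ i → extends φ (suc i)
  ; nonempty   = λ i → nonempty φ (suc i)
  }

face₀⊆bottom-tail : (φ : Flag (suc k) n) → face φ zero ⊆ bottom (tail φ)
face₀⊆bottom-tail φ = subst (face φ zero ⊆_) (sym (extends φ zero)) (p⊆p∪q _)

newVertex₀∈bottom-tail : (φ : Flag (suc k) n) → newVertex φ zero ∈ bottom (tail φ)
newVertex₀∈bottom-tail φ =
  subst (newVertex φ zero ∈_) (sym (extends φ zero)) (x∈p∪q⁺ (inj₂ (x∈⁅x⁆ _)))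

bottom⊆face : (φ : Flag k n) (i : Fin k) → bottom φ ⊆ face φ i
bottom⊆face φ zero    = λ x∈ → x∈
bottom⊆face φ (suc i) = bottom⊆face (tail φ) i ∘ face₀⊆bottom-tail φ

newVertex∉bottom : (φ : Flag k n) (i : Fin k) → newVertex φ i ∉ bottom φ
newVertex∉bottom φ i = newVertex∉ φ i ∘ bottom⊆face φ i

newVertex-injective : (φ : Flag k n) (i j : Fin k) → newVertex φ i ≡ newVertex φ j → i ≡ j
newVertex-injective φ zero    zero    _ = refl
newVertex-injective φ zero    (suc j) e =
  ⊥-elim (newVertex∉bottom (tail φ) j (subst (_∈ bottom (tail φ)) e (newVertex₀∈bottom-tail φ)))
newVertex-injective φ (suc i) zero    e =
  ⊥-elim (newVertex∉bottom (tail φ) i (subst (_∈ bottom (tail φ)) (sym e) (newVertex₀∈bottom-tail φ)))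
newVertex-injective φ (suc i) (suc j) e = cong suc (newVertex-injective (tail φ) i j e)

bottom-or-newVertex : (φ : Flag k n) (x : Fin n) → x ∈ bottom φ ⊎ ∃ λ i → x ≡ newVertex φ i
bottom-or-newVertex {zero}  φ x = inj₁ ∈⊤
bottom-or-newVertex {suc k} φ x with bottom-or-newVertex (tail φ) x
... | inj₂ (i , x≡) = inj₂ (suc i , x≡)
... | inj₁ x∈ with x∈p∪q⁻ (face φ zero) _ (subst (x ∈_) (extends φ zero) x∈)
...   | inj₁ x∈F = inj₁ x∈F
...   | inj₂ x∈⁅v⁆ = inj₂ (zero , x∈⁅y⁆⇒x≡y _ x∈⁅v⁆)

-- Faces of the subdivision along a flag

-- In Fin (k + n) the apex of the subdivision at face i is i ↑ˡ n and the
-- original vertex x is k ↑ʳ x, so drop k S is the set of original vertices of S.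
ApexCondition : Flag k n → Subset (k + n) → Set
ApexCondition {k} {n} φ S = ∀ i → i ↑ˡ n ∈ S → newVertex φ i ∉ drop k S

FlagFace : Flag k n → Complex (k + n)
FlagFace {k} φ S = ¬ (bottom φ ⊆ drop k S) × ApexCondition φ S

ApexCondition-⊆ : (φ : Flag k n) {S T : Subset (k + n)} →
  T ⊆ S → ApexCondition φ S → ApexCondition φ T
ApexCondition-⊆ {k} φ T⊆S apexOK i a∈T w∈T = apexOK i (T⊆S a∈T) (drop-mono {k} T⊆S w∈T)

Boundary : Complex n
Boundary S = ¬ (S ≡ ⊤)

module StellarStep (φ : Flag (suc k) n) (L : Complex (k + n))
                   (L⇔ : ∀ S → L S ⇔ FlagFace (tail φ) S) where

  F : Subset n
  F = face φ zero

  v : Fin n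
  v = newVertex φ zero

  F' : Subset (k + n)
  F' = liftSub k F

  join⇒ : {S : Subset (k + n)} → BdJoinLink L F' S →
    ¬ (F ⊆ drop k S) × v ∉ drop k S × ApexCondition (tail φ) S
  join⇒ (G , H , (G⊆F' , y , y∈F' , y∉G) , (_ , H∩F'≡⊥ , LH∪F') , refl) =
    F⊈ , v∉ , λ i a∈ w∈ → proj₂ H∪F'-face i (S⊆H∪F' a∈) (drop-mono {k} S⊆H∪F' w∈)
    where
    H∪F'-face : FlagFace (tail φ) (H ∪ F')
    H∪F'-face = L⇔ (H ∪ F') .to LH∪F'

    S⊆H∪F' : G ∪ H ⊆ H ∪ F'
    S⊆H∪F' x∈ with x∈p∪q⁻ G H x∈
    ... | inj₁ x∈G = x∈p∪q⁺ (inj₂ (G⊆F' x∈G))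
    ... | inj₂ x∈H = x∈p∪q⁺ (inj₁ x∈H)

    F⊈ : ¬ (F ⊆ drop k (G ∪ H))
    F⊈ F⊆ with x∈p∪q⁻ G H (liftSub-⊆ {k = k} F⊆ y∈F')
    ... | inj₁ y∈G = y∉G y∈G
    ... | inj₂ y∈H = ∉⊥ (subst (y ∈_) H∩F'≡⊥ (x∈p∩q⁺ (y∈H , y∈F')))

    v∉ : v ∉ drop k (G ∪ H)
    v∉ v∈ = proj₁ H∪F'-face (subst (_⊆ drop k (H ∪ F')) (sym (extends φ zero))
      (∪⁅⁆⊆ (λ x∈F → ∈-drop⁺ {k} (x∈p∪q⁺ (inj₂ (↑ʳ∈liftSub⁺ {k = k} x∈F))))
            (drop-mono {k} S⊆H∪F' v∈)))

  ⇒join : {S : Subset (k + n)} → ¬ (F ⊆ drop k S) → v ∉ drop k S →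
    ApexCondition (tail φ) S → BdJoinLink L F' S
  ⇒join {S} F⊈ v∉ apexOK =
    S ∩ F' , H , G⊂F' , (L⇔ H .from (H-bottom , ApexCondition-⊆ (tail φ) H⊆S apexOK) , H∩F'≡⊥ ,
                         L⇔ (H ∪ F') .from (H∪F'-bottom , H∪F'-apex)) , S≡G∪H
    where
    open ≡-Reasoning

    H : Subset (k + n)
    H = S ∩ ∁ F'

    H⊆S : H ⊆ S
    H⊆S = p∩q⊆p S (∁ F')

    H∌F' : ∀ {x} → x ∈ H → x ∉ F'
    H∌F' x∈H = x∈∁p⇒x∉p (proj₂ (x∈p∩q⁻ S (∁ F') x∈H))

    G⊂F' : S ∩ F' ⊂ F'
    G⊂F' =
      let y , y∈F' , y∉S = ⊈⇒∃∉ (F⊈ ∘ liftSub-⊆⁻ {k = k})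
      in p∩q⊆q S F' , y , y∈F' , y∉S ∘ proj₁ ∘ x∈p∩q⁻ S F'

    H-bottom : ¬ (bottom (tail φ) ⊆ drop k H)
    H-bottom bottom⊆ =
      let e , e∈F = nonempty φ zero
      in H∌F' (∈-drop⁻ {k} (bottom⊆ (face₀⊆bottom-tail φ e∈F))) (↑ʳ∈liftSub⁺ {k = k} e∈F)

    H∩F'≡⊥ : H ∩ F' ≡ ⊥
    H∩F'≡⊥ = begin
      (S ∩ ∁ F') ∩ F' ≡⟨ ∩-assoc S (∁ F') F' ⟩
      S ∩ (∁ F' ∩ F') ≡⟨ cong (S ∩_) (∩-inverseˡ F') ⟩
      S ∩ ⊥           ≡⟨ ∩-zeroʳ S ⟩
      ⊥               ∎

    H∪F'-bottom : ¬ (bottom (tail φ) ⊆ drop k (H ∪ F'))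
    H∪F'-bottom bottom⊆ with x∈p∪q⁻ H F' (∈-drop⁻ {k} (bottom⊆ (newVertex₀∈bottom-tail φ)))
    ... | inj₁ v∈H = v∉ (∈-drop⁺ {k} (H⊆S v∈H))
    ... | inj₂ v∈F' = newVertex∉ φ zero (↑ʳ∈liftSub⁻ {k = k} v∈F')

    H∪F'-apex : ApexCondition (tail φ) (H ∪ F')
    H∪F'-apex i a∈ w∈ with x∈p∪q⁻ H F' a∈ | x∈p∪q⁻ H F' (∈-drop⁻ {k} w∈)
    ... | inj₂ a∈F' | _          = ↑ˡ∉liftSub i a∈F'
    ... | inj₁ a∈H  | inj₁ w∈H  = apexOK i (H⊆S a∈H) (∈-drop⁺ {k} (H⊆S w∈H))
    ... | inj₁ _    | inj₂ w∈F' = newVertex∉bottom φ (suc i) (↑ʳ∈liftSub⁻ {k = k} w∈F')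

    S≡G∪H : S ≡ (S ∩ F') ∪ H
    S≡G∪H = begin
      S                         ≡⟨ ∩-identityʳ S ⟨
      S ∩ ⊤                     ≡⟨ cong (S ∩_) (∪-inverseʳ F') ⟨
      S ∩ (F' ∪ ∁ F')           ≡⟨ ∩-distribˡ-∪ S F' (∁ F') ⟩
      (S ∩ F') ∪ H              ∎

  sd⇔FlagFace : ∀ b S → sd F' L (b ∷ S) ⇔ FlagFace φ (b ∷ S)
  sd⇔FlagFace false S = mk⇔ to′ from′
    where
    to′ : sd F' L (false ∷ S) → FlagFace φ (false ∷ S)
    to′ (inj₁ (LS , F'⊈S)) = F'⊈S ∘ liftSub-⊆ {k = k} ,
      λ { (suc i) (there a∈) → proj₂ (L⇔ S .to LS) i a∈ }
    to′ (inj₂ J) = let F⊈ , _ , apexOK = join⇒ J in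
      F⊈ , λ { (suc i) (there a∈) → apexOK i a∈ }

    from′ : FlagFace φ (false ∷ S) → sd F' L (false ∷ S)
    from′ (F⊈ , apexOK) = inj₁ (L⇔ S .from ((λ bottom⊆ → F⊈ (bottom⊆ ∘ face₀⊆bottom-tail φ)) ,
                                             λ i a∈ → apexOK (suc i) (there a∈)) ,
                                F⊈ ∘ liftSub-⊆⁻ {k = k})
  sd⇔FlagFace true S = mk⇔
    (λ J → let F⊈ , v∉ , apexOK = join⇒ J in
      F⊈ , λ { zero here → v∉ ; (suc i) (there a∈) → apexOK i a∈ })
    (λ (F⊈ , apexOK) → ⇒join F⊈ (apexOK zero here) (λ i a∈ → apexOK (suc i) (there a∈)))

sdChain⇔FlagFace : (φ : Flag k n) (S : Subset (k + n)) →
  sdChain k (face φ) Boundary S ⇔ FlagFace φ S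
sdChain⇔FlagFace {zero} φ S = mk⇔
  (λ S≢⊤ → S≢⊤ ∘ ⊤⊆⇒≡⊤ , λ ())
  (λ (⊤⊈S , _) S≡⊤ → ⊤⊈S (⊆-reflexive (sym S≡⊤)))
  where
  ⊤⊆⇒≡⊤ : ⊤ ⊆ S → S ≡ ⊤
  ⊤⊆⇒≡⊤ ⊤⊆S = ⊆-antisym ⊆⊤ ⊤⊆S
sdChain⇔FlagFace {suc k} φ (b ∷ S) =
  StellarStep.sd⇔FlagFace φ _ (sdChain⇔FlagFace (tail φ)) b S

-- Chains of faces of consecutive sizes are complete flags

withTop-∣∣ : (c : ℕ) (Fs : Fin k → Subset n) → (∀ i → ∣ Fs i ∣ ≡ c + toℕ i) → n ≡ c + k →
  ∀ j → ∣ withTop Fs j ∣ ≡ c + toℕ j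
withTop-∣∣ {zero} {n} c Fs _ n≡ zero = trans (∣⊤∣≡n n) n≡
withTop-∣∣ {suc k} c Fs ∣Fs∣ _ zero = ∣Fs∣ zero
withTop-∣∣ {suc k} c Fs ∣Fs∣ n≡ (suc j) = trans
  (withTop-∣∣ (suc c) (λ i → Fs (suc i)) (λ i → trans (∣Fs∣ (suc i)) (+-suc c (toℕ i)))
              (trans n≡ (+-suc c k)) j)
  (sym (+-suc c (toℕ j)))

withTop-⊇ : (Fs : Fin k → Subset n) → (∀ i j → i ≤ j → Fs i ⊆ Fs j) →
  ∀ i → Fs i ⊆ withTop Fs (suc i)
withTop-⊇ {suc zero}    Fs mono zero    = ⊆⊤
withTop-⊇ {suc (suc k)} Fs mono zero    = mono zero (suc zero) z≤n
withTop-⊇ {suc (suc k)} Fs mono (suc i) =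
  withTop-⊇ (λ j → Fs (suc j)) (λ i j i≤j → mono (suc i) (suc j) (s≤s i≤j)) i

chainFlag : (c : ℕ) (Fs : Fin k → Subset n) → (∀ i → ∣ Fs i ∣ ≡ suc c + toℕ i) →
  n ≡ suc c + k → (∀ i j → i ≤ j → Fs i ⊆ Fs j) → Flag k n
chainFlag c Fs ∣Fs∣ n≡ mono = record
  { face       = Fs
  ; newVertex  = λ i → proj₁ (oneMore i)
  ; newVertex∉ = λ i → proj₁ (proj₂ (oneMore i))
  ; extends    = λ i → proj₂ (proj₂ (oneMore i))
  ; nonempty   = λ i → nonempty-∣∣ (∣Fs∣ i)
  }
  where
  oneMore : ∀ i → ∃ λ v → v ∉ Fs i × withTop Fs (suc i) ≡ Fs i ∪ ⁅ v ⁆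
  oneMore i = ⊆∧∣∣≡suc⇒∪⁅⁆ (withTop-⊇ Fs mono i) (begin
    ∣ withTop Fs (suc i) ∣ ≡⟨ withTop-∣∣ (suc c) Fs ∣Fs∣ n≡ (suc i) ⟩
    suc c + suc (toℕ i)    ≡⟨ +-suc (suc c) (toℕ i) ⟩
    suc (suc c + toℕ i)    ≡⟨ cong suc (∣Fs∣ i) ⟨
    suc ∣ Fs i ∣           ∎)
    where open ≡-Reasoning

-- The cross-polytope

↑ˡ≢↑ʳ : (i : Fin k) (x : Fin n) → i ↑ˡ n ≢ k ↑ʳ x
↑ˡ≢↑ʳ {k} {n} i x e with trans (sym (splitAt-↑ˡ k i n)) (trans (cong (splitAt k) e) (splitAt-↑ʳ k n x))
... | ()

∈-relabel : (f : Fin m → Fin n) (S : Subset n) (j : Fin m) →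
  j ∈ tabulate (λ j → lookup S (f j)) ⇔ f j ∈ S
∈-relabel f S j = mk⇔
  (λ j∈ → lookup⇒[]= (f j) S (trans (sym (lookup∘tabulate _ j)) ([]=⇒lookup j∈)))
  (λ fj∈ → lookup⇒[]= j _ (trans (lookup∘tabulate _ j) ([]=⇒lookup fj∈)))

≅-respˡ-⇔ : {K K' : Complex n} {L : Complex m} → (∀ S → K S ⇔ K' S) → K' ≅ L → K ≅ L
≅-respˡ-⇔ K⇔K' (σ , K'⇔L) = σ , λ S → ⇔.trans (K⇔K' S) (K'⇔L S)

module CrossPolytope (φ : Flag k (suc (suc k))) {u u' : Fin (suc (suc k))} (u≢u' : u ≢ u')
                     (bottom≡ : bottom φ ≡ ⁅ u ⁆ ∪ ⁅ u' ⁆) where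

  u∈bottom : u ∈ bottom φ
  u∈bottom = subst (u ∈_) (sym bottom≡) (x∈p∪q⁺ (inj₁ (x∈⁅x⁆ u)))

  u'∈bottom : u' ∈ bottom φ
  u'∈bottom = subst (u' ∈_) (sym bottom≡) (x∈p∪q⁺ (inj₂ (x∈⁅x⁆ u')))

  enumerate : Fin (suc (suc k)) → Fin (suc (suc k))
  enumerate zero          = u
  enumerate (suc zero)    = u'
  enumerate (suc (suc i)) = newVertex φ i

  enumerate-injective : ∀ a b → enumerate a ≡ enumerate b → a ≡ b
  enumerate-injective zero          zero          _ = refl
  enumerate-injective (suc zero)    (suc zero)    _ = refl
  enumerate-injective zero          (suc zero)    e = ⊥-elim (u≢u' e)
  enumerate-injective (suc zero)    zero          e = ⊥-elim (u≢u' (sym e))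
  enumerate-injective zero          (suc (suc j)) e =
    ⊥-elim (newVertex∉bottom φ j (subst (_∈ bottom φ) e u∈bottom))
  enumerate-injective (suc zero)    (suc (suc j)) e =
    ⊥-elim (newVertex∉bottom φ j (subst (_∈ bottom φ) e u'∈bottom))
  enumerate-injective (suc (suc i)) zero          e =
    ⊥-elim (newVertex∉bottom φ i (subst (_∈ bottom φ) (sym e) u∈bottom))
  enumerate-injective (suc (suc i)) (suc zero)    e =
    ⊥-elim (newVertex∉bottom φ i (subst (_∈ bottom φ) (sym e) u'∈bottom))
  enumerate-injective (suc (suc i)) (suc (suc j)) e =
    cong (λ a → suc (suc a)) (newVertex-injective φ i j e)

  enumerate-surjective : ∀ x → ∃ λ a → enumerate a ≡ x
  enumerate-surjective x with bottom-or-newVertex φ x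
  ... | inj₂ (i , x≡) = suc (suc i) , sym x≡
  ... | inj₁ x∈ with x∈p∪q⁻ ⁅ u ⁆ ⁅ u' ⁆ (subst (x ∈_) bottom≡ x∈)
  ...   | inj₁ x∈⁅u⁆  = zero , sym (x∈⁅y⁆⇒x≡y u x∈⁅u⁆)
  ...   | inj₂ x∈⁅u'⁆ = suc zero , sym (x∈⁅y⁆⇒x≡y u' x∈⁅u'⁆)

  -- The vertices x_i, y_i of Cross k are inj₁ i, inj₂ i: x_0 = u, y_0 = u',
  -- x_{i+1} is the apex of the subdivision at face i, y_{i+1} = newVertex φ i.
  crossVertex : Fin (suc k) ⊎ Fin (suc k) → Fin (k + suc (suc k))
  crossVertex (inj₁ zero)    = k ↑ʳ enumerate zero
  crossVertex (inj₁ (suc i)) = i ↑ˡ suc (suc k)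
  crossVertex (inj₂ i)       = k ↑ʳ enumerate (suc i)

  crossVertex-injective : ∀ s t → crossVertex s ≡ crossVertex t → s ≡ t
  crossVertex-injective (inj₁ zero)    (inj₁ zero)    _ = refl
  crossVertex-injective (inj₁ zero)    (inj₁ (suc j)) e = ⊥-elim (↑ˡ≢↑ʳ j u (sym e))
  crossVertex-injective (inj₁ zero)    (inj₂ j)       e
    with enumerate-injective zero (suc j) (↑ʳ-injective k _ _ e)
  ... | ()
  crossVertex-injective (inj₁ (suc i)) (inj₁ zero)    e = ⊥-elim (↑ˡ≢↑ʳ i u e)
  crossVertex-injective (inj₁ (suc i)) (inj₁ (suc j)) e = cong (inj₁ ∘ suc) (↑ˡ-injective _ i j e)
  crossVertex-injective (inj₁ (suc i)) (inj₂ j)       e = ⊥-elim (↑ˡ≢↑ʳ i _ e)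
  crossVertex-injective (inj₂ i)       (inj₁ zero)    e
    with enumerate-injective (suc i) zero (↑ʳ-injective k _ _ e)
  ... | ()
  crossVertex-injective (inj₂ i)       (inj₁ (suc j)) e = ⊥-elim (↑ˡ≢↑ʳ j _ (sym e))
  crossVertex-injective (inj₂ i)       (inj₂ j)       e =
    cong inj₂ (fsuc-injective (enumerate-injective (suc i) (suc j) (↑ʳ-injective k _ _ e)))

  crossVertex-surjective : ∀ y → ∃ λ s → crossVertex s ≡ y
  crossVertex-surjective y with splitAt k y in split≡
  ... | inj₁ i = inj₁ (suc i) , splitAt⁻¹-↑ˡ split≡
  ... | inj₂ x with enumerate-surjective x
  ...   | zero  , a↦x = inj₁ zero , trans (cong (k ↑ʳ_) a↦x) (splitAt⁻¹-↑ʳ split≡)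
  ...   | suc a , a↦x = inj₂ a , trans (cong (k ↑ʳ_) a↦x) (splitAt⁻¹-↑ʳ split≡)

  vertices : Fin (suc k + suc k) ↔ Fin (k + suc (suc k))
  vertices = ↔-trans +↔⊎ (⤖⇒↔ (mk⤖ (crossVertex-injective _ _ ,
    strictlySurjective⇒surjective crossVertex-surjective)))

  FlagFace⇔NoPair : (S : Subset (k + suc (suc k))) → FlagFace φ S ⇔
    (∀ i → ¬ (crossVertex (inj₁ i) ∈ S × crossVertex (inj₂ i) ∈ S))
  FlagFace⇔NoPair S = mk⇔ to′ from′
    where
    to′ : FlagFace φ S → ∀ i → ¬ (crossVertex (inj₁ i) ∈ S × crossVertex (inj₂ i) ∈ S)
    to′ (bottom⊈ , _) zero (u∈ , u'∈) = bottom⊈ (subst (_⊆ drop k S) (sym bottom≡)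
      (∪⁅⁆⊆ (⁅⁆⊆ (∈-drop⁺ {k} u∈)) (∈-drop⁺ {k} u'∈)))
    to′ (_ , apexOK) (suc i) (a∈ , w∈) = apexOK i a∈ (∈-drop⁺ {k} w∈)

    from′ : (∀ i → ¬ (crossVertex (inj₁ i) ∈ S × crossVertex (inj₂ i) ∈ S)) → FlagFace φ S
    from′ noPair =
      (λ bottom⊆ → noPair zero (∈-drop⁻ {k} (bottom⊆ u∈bottom) , ∈-drop⁻ {k} (bottom⊆ u'∈bottom))) ,
      λ i a∈ w∈ → noPair (suc i) (a∈ , ∈-drop⁻ {k} w∈)

  FlagFace≅Cross : FlagFace φ ≅ Cross k
  FlagFace≅Cross = ↔-sym vertices , λ S → ⇔.trans (FlagFace⇔NoPair S) (mk⇔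
    (λ noPair i (x∈ , y∈) → noPair i (x⇔ S i .to x∈ , y⇔ S i .to y∈))
    (λ cross i (x∈ , y∈) → cross i (x⇔ S i .from x∈ , y⇔ S i .from y∈)))
    where
    T : Subset (k + suc (suc k)) → Subset (suc k + suc k)
    T S = tabulate (λ j → lookup S (Inverse.from (↔-sym vertices) j))

    x⇔ : ∀ S i → (i ↑ˡ suc k) ∈ T S ⇔ crossVertex (inj₁ i) ∈ S
    x⇔ S i = subst (λ s → (i ↑ˡ suc k) ∈ T S ⇔ crossVertex s ∈ S) (splitAt-↑ˡ (suc k) i (suc k))
                   (∈-relabel (Inverse.from (↔-sym vertices)) S (i ↑ˡ suc k))

    y⇔ : ∀ S i → (suc k ↑ʳ i) ∈ T S ⇔ crossVertex (inj₂ i) ∈ S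
    y⇔ S i = subst (λ s → (suc k ↑ʳ i) ∈ T S ⇔ crossVertex s ∈ S) (splitAt-↑ʳ (suc k) (suc k) i)
                   (∈-relabel (Inverse.from (↔-sym vertices)) S (suc k ↑ʳ i))


lemma3p6 : (d : ℕ) (F : Fin d → Subset (suc (suc d)))
    → ((i : Fin d) → BdSimplex d (F i))
    → ((i : Fin d) → ∣ F i ∣ ≡ suc (suc (toℕ i)))
    → ((i j : Fin d) → i ≤ j → F i ⊆ F j)
    → sdChain d F (BdSimplex d) ≅ Cross d
lemma3p6 d F _ ∣F∣ chain =
  ≅-respˡ-⇔ {L = Cross d} (sdChain⇔FlagFace φ) (CrossPolytope.FlagFace≅Cross φ u≢u' bottom≡)
  where
  φ : Flag d (suc (suc d))
  φ = chainFlag 1 F ∣F∣ refl chain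

  ∣bottom∣ : ∣ bottom φ ∣ ≡ 2
  ∣bottom∣ = withTop-∣∣ 2 F ∣F∣ refl zero

  bottom-nonempty : Nonempty (bottom φ)
  bottom-nonempty = nonempty-∣∣ ∣bottom∣

  u : Fin (suc (suc d))
  u = proj₁ bottom-nonempty

  edge : ∃ λ u' → u' ∉ ⁅ u ⁆ × bottom φ ≡ ⁅ u ⁆ ∪ ⁅ u' ⁆
  edge = ⊆∧∣∣≡suc⇒∪⁅⁆ (⁅⁆⊆ (proj₂ bottom-nonempty))
                     (trans ∣bottom∣ (cong suc (sym (∣⁅x⁆∣≡1 u))))

  u≢u' : u ≢ proj₁ edge
  u≢u' = x∉⁅y⁆⇒x≢y (proj₁ (proj₂ edge)) ∘ sym

  bottom≡ : bottom φ ≡ ⁅ u ⁆ ∪ ⁅ proj₁ edge ⁆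
  bottom≡ = proj₂ (proj₂ edge)
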